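{- If $A$ is a nonzero $1\times 2$ matrix with rational entries, then $A$ is not rainbow regular.
   Context: For a positive integer $N$, $[N]=\{1,\dots,N\}$. A $k$-coloring of a set $X$ is a surjective map $c:X\to\{1,\dots,k\}$; its color classes are the preimages of single colors. A $k$-coloring of $[kn]$ is equinumerous if every color class has exactly $n$ elements. Given a coloring of a set $S$ of integers, a vector is rainbow if all its entries lie in $S$ and its entries receive pairwise distinct colors. A rational matrix $A$ is rainbow partition $k$-regular if for all positive integers $n$ and every equinumerous $k$-coloring of $[kn]$ there exists a rainbow vector in $\ker(A)$. $A$ is rainbow regular if it is rainbow partition $k$-regular for all sufficiently large $k$. -}

module Defs where

open import Data.Nat using (ℕ; zero; suc; _*_; _≤_)
open import Data.Integer using (+_)
open import Data.Rational using (ℚ; 0ℚ; _/_) renaming (_+_ to _+ℚ_; _*_ to _*ℚ_)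
open import Data.Fin using (Fin; zero; suc; toℕ; _≟_)
open import Data.List using (length; filter; allFin)
open import Data.Product using (Σ; ∃; _×_; _,_)
open import Relation.Binary.PropositionalEquality using (_≡_)
open import Relation.Nullary using (¬_)

Matrix : ℕ → ℕ → Set
Matrix m l = Fin m → Fin l → ℚ

sumℚ : ∀ {l} → (Fin l → ℚ) → ℚ
sumℚ {zero} f = 0ℚ
sumℚ {suc l} f = f zero +ℚ sumℚ (λ i → f (suc i))

ℕ→ℚ : ℕ → ℚ
ℕ→ℚ m = (+ m) / 1

InKer : ∀ {m l} → Matrix m l → (Fin l → ℚ) → Set
InKer A x = ∀ i → sumℚ (λ j → A i j *ℚ x j) ≡ 0ℚ

-- The set [N] = {1,…,N} is represented by Fin N, element i standing for toℕ i + 1.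
elem : ∀ {N} → Fin N → ℕ
elem i = suc (toℕ i)

Surjective : ∀ {N k} → (Fin N → Fin k) → Set
Surjective {N} {k} c = ∀ (j : Fin k) → ∃ λ (i : Fin N) → c i ≡ j

classSize : ∀ {N k} → (Fin N → Fin k) → Fin k → ℕ
classSize {N} c j = length (filter (λ i → c i ≟ j) (allFin N))

Equinumerous : (k n : ℕ) → (Fin (k * n) → Fin k) → Set
Equinumerous k n c = Surjective c × (∀ (j : Fin k) → classSize c j ≡ n)

Rainbow : ∀ {N k l} → (Fin N → Fin k) → (Fin l → Fin N) → Set
Rainbow c x = ∀ j j' → c (x j) ≡ c (x j') → j ≡ j'

RainbowPartitionRegular : ∀ {m l} → Matrix m l → ℕ → Set
RainbowPartitionRegular {m} {l} A k =
  ∀ (n : ℕ) → 1 ≤ n → (c : Fin (k * n) → Fin k) → Equinumerous k n c →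
  ∃ λ (x : Fin l → Fin (k * n)) → Rainbow c x × InKer A (λ j → ℕ→ℚ (elem (x j)))

RainbowRegular : ∀ {m l} → Matrix m l → Set
RainbowRegular A = ∃ λ (K : ℕ) → ∀ (k : ℕ) → K ≤ k → RainbowPartitionRegular A k

NonzeroMatrix : ∀ {m l} → Matrix m l → Set
NonzeroMatrix A = ∃ λ i → ∃ λ j → ¬ (A i j ≡ 0ℚ)

module Submission where

-- Writing the kernel equation a x + b y = 0 as P x = Q y with P, Q ∈ ℕ not both zero, it
-- suffices to find, for every K, an equinumerous colouring with at least K colours in which
-- P x = Q y forces x and y to share a colour: then no kernel vector is rainbow.  If P = Q, or
-- P or Q is 0, colour every number differently.  Otherwise divide by gcd P Q and assume
-- P = Q + D > Q.  Take a prime j > D + K + 4 and m = (P^j − Q^j)/(P − Q).  Modulo m, Q is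
-- invertible, P^j ≡ Q^j, and m is coprime to D and at least K j + 2; hence v ↦ P v Q⁻¹ maps
-- [m − 1] to itself, has order j and no fixed point, so all its orbits have exactly j elements.
-- Colour [m − 1] by orbits: P x = Q y says that y is the image of x.

open import Defs
open import Algebra.Bundles using (AbelianGroup)
open import Data.Bool using (Bool; true; false; _∨_; _∧_; if_then_else_)
open import Data.Empty using (⊥-elim)
open import Data.Fin using (Fin; zero; suc; _≟_; toℕ; fromℕ<)
open import Data.Fin.Properties using (any?; suc-injective; 0≢1+n; toℕ<n; toℕ-fromℕ<; toℕ-injective)
open import Data.Integer as ℤ using (0ℤ; 1ℤ; ∣_∣)
import Data.Integer.Properties as ℤ
open import Data.Integer.Tactic.RingSolver using () renaming (solve-∀ to ℤ-solve-∀)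
open import Data.List using (List; []; _∷_; length; filter; tabulate; allFin; lookup)
open import Data.List.Membership.Propositional using (_∈_)
open import Data.List.Membership.Propositional.Properties using (∈-filter⁺; ∈-filter⁻; ∈-allFin; ∈-lookup)
import Data.List.Relation.Unary.All as All
open import Data.List.Relation.Unary.AllPairs using (_∷_)
open import Data.List.Relation.Unary.Any using (here; there; index)
open import Data.List.Relation.Unary.Any.Properties using (lookup-index)
open import Data.List.Relation.Unary.Unique.Propositional using (Unique)
import Data.List.Relation.Unary.Unique.Propositional.Properties as Unique
open import Data.Nat using (ℕ; zero; suc; _+_; _*_; _∸_; _^_; _≤_; _<_; s≤s; z≤n; s≤s⁻¹; _%_; _/_; _!; pred;
  NonZero; >-nonZero; >-nonZero⁻¹; ≢-nonZero; ≢-nonZero⁻¹)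
import Data.Nat.Properties as ℕ
open import Data.Nat.Properties using (+-0-commutativeMonoid; +-comm; *-comm; *-identityʳ; suc-pred; <⇒≤;
  ≤-<-trans; m∸n≤m; m∸n+n≡m; m<n⇒0<n∸m; m+[n∸m]≡n)
open import Data.Nat.Coprimality using (Coprime; coprime-Bézout; coprime-divisor; coprime-/gcd; prime⇒coprime)
import Data.Nat.Coprimality as Coprime
open import Data.Nat.Divisibility using (_∣_; divides; ∣-trans; ∣1⇒≡1; ∣⇒≤; ∣m+n∣m⇒∣n; ∣m∣n⇒∣m+n; ∣m⇒∣m*n;
  m∣m*n; m≤n⇒m!∣n!)
open import Data.Nat.DivMod using (m≡m%n+[m/n]*n; m%n<n; m%n%n≡m%n; %-distribˡ-*; m<n⇒m%n≡m;
  [m+kn]%n≡m%n; m/n*n≡m)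
open import Data.Nat.GCD using (module Bézout; gcd; gcd[m,n]∣m; gcd[m,n]∣n; gcd[m,n]≢0)
open import Data.Nat.GeneralisedArithmetic using (fold; iterate; fold-+; iterate-is-fold)
open import Data.Nat.ListAction using (product)
open import Data.Nat.Primality using (Prime; prime⇒nonZero; prime⇒irreducible; ¬prime[0]; ¬prime[1])
open import Data.Nat.Primality.Factorisation using (PrimeFactorisation; factorise)
open import Data.Nat.Tactic.RingSolver using (solve-∀)
open import Data.Product using (Σ; ∃; _×_; _,_; proj₁; proj₂)
open import Data.Rational as ℚ using (ℚ; 0ℚ; mkℚ; ↥_; ↧_; toℚᵘ) renaming (_+_ to _+ℚ_; _*_ to _*ℚ_)
open import Data.Rational.Properties using (toℚᵘ-homo-+; toℚᵘ-homo-*; toℚᵘ-cong; normalize-coprime; ↥p≡0⇒p≡0)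
import Data.Rational.Unnormalised as ℚᵘ
import Data.Rational.Unnormalised.Properties as ℚᵘ
open import Data.Sum using (inj₁; inj₂)
open import Function using (_∘_; id)
open import Function.Bundles using (_⇔_; mk⇔; Equivalence)
open import Function.Definitions using (Injective)
open import Level using (0ℓ)
open import Relation.Binary using (Rel; IsEquivalence; tri<; tri≈; tri>)
import Relation.Binary as Binary
open import Relation.Binary.PropositionalEquality
open import Relation.Nullary using (¬_; Dec; yes; no; does)
import Relation.Nullary.Decidable as Dec
open import Relation.Nullary.Decidable using (dec-false; does-⇔)
open import Relation.Unary using (Pred; Decidable)
open import Algebra.Properties.CommutativeMonoid.Sum +-0-commutativeMonoid
  using (sum; ∑-comm; ∑-distrib-+; sum-cong-≗; sum-replicate-zero)
open import Algebra.Properties.Group (AbelianGroup.group ℤ.+-0-abelianGroup) using (inverseˡ-unique)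

indicator : Bool → ℕ
indicator true = 1
indicator false = 0

count : ∀ {N} → (Fin N → Bool) → ℕ
count p = sum (λ i → indicator (p i))

count-cong : ∀ {N} {p q : Fin N → Bool} → (∀ i → p i ≡ q i) → count p ≡ count q
count-cong p≗q = sum-cong-≗ (cong indicator ∘ p≗q)

count-false : ∀ {N} → count {N} (λ _ → false) ≡ 0
count-false {N} = sum-replicate-zero N

indicator-∨ : ∀ a b → a ∧ b ≡ false → indicator (a ∨ b) ≡ indicator a + indicator b
indicator-∨ true true ()
indicator-∨ true false _ = refl
indicator-∨ false b _ = refl

count-∨ : ∀ {N} (p q : Fin N → Bool) → (∀ i → p i ∧ q i ≡ false) →
  count (λ i → p i ∨ q i) ≡ count p + count q
count-∨ p q disjoint =
  trans (sum-cong-≗ (λ i → indicator-∨ (p i) (q i) (disjoint i))) (∑-distrib-+ (indicator ∘ p) (indicator ∘ q))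

count-≟ˡ : ∀ {N} (a : Fin N) → count (λ i → does (a ≟ i)) ≡ 1
count-≟ˡ {suc N} zero = cong suc (count-false {N})
count-≟ˡ (suc a) = count-≟ˡ a

count-≟ʳ : ∀ {N} (a : Fin N) → count (λ i → does (i ≟ a)) ≡ 1
count-≟ʳ {suc N} zero = cong suc (count-false {N})
count-≟ʳ (suc a) = count-≟ʳ a

∑-const : ∀ {k} n → sum {k} (λ _ → n) ≡ k * n
∑-const {zero} n = refl
∑-const {suc k} n = cong (n +_) (∑-const {k} n)

∑-count-fibres : ∀ {N k} (c : Fin N → Fin k) → sum (λ ℓ → count (λ x → does (c x ≟ ℓ))) ≡ N
∑-count-fibres {N} c = begin
  sum (λ ℓ → sum (λ x → indicator (does (c x ≟ ℓ)))) ≡⟨ ∑-comm (λ x ℓ → indicator (does (c x ≟ ℓ))) ⟨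
  sum (λ x → count (λ ℓ → does (c x ≟ ℓ)))         ≡⟨ sum-cong-≗ (count-≟ˡ ∘ c) ⟩
  sum {N} (λ _ → 1)                                 ≡⟨ ∑-const {N} 1 ⟩
  N * 1                                             ≡⟨ *-identityʳ N ⟩
  N                                                 ∎
  where open ≡-Reasoning

image? : ∀ {t N} (g : Fin t → Fin N) (y : Fin N) → Dec (∃ λ i → g i ≡ y)
image? g y = any? (λ i → g i ≟ y)

count-image : ∀ {t N} (g : Fin t → Fin N) → Injective _≡_ _≡_ g →
  count (λ y → does (image? g y)) ≡ t
count-image {zero} {N} g _ = count-false {N}
count-image {suc t} g g-inj =
  trans (count-∨ (λ y → does (g zero ≟ y)) (λ y → does (image? (g ∘ suc) y)) disjoint)
        (cong₂ _+_ (count-≟ˡ (g zero)) (count-image (g ∘ suc) (suc-injective ∘ g-inj)))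
  where
    disjoint : ∀ y → does (g zero ≟ y) ∧ does (image? (g ∘ suc) y) ≡ false
    disjoint y with g zero ≟ y
    ... | no _ = refl
    ... | yes refl = dec-false (image? (g ∘ suc) (g zero)) (λ (i , e) → 0≢1+n (g-inj (sym e)))

length-filter-allFin : ∀ {N p} {P : Pred (Fin N) p} (P? : Decidable P) →
  length (filter P? (allFin N)) ≡ count (does ∘ P?)
length-filter-allFin {N} P? = length-filter-tabulate id
  where
    length-filter-tabulate : ∀ {M} (g : Fin M → Fin N) →
      length (filter P? (tabulate g)) ≡ count (does ∘ P? ∘ g)
    length-filter-tabulate {zero} g = refl
    length-filter-tabulate {suc M} g with does (P? (g zero))
    ... | true = cong suc (length-filter-tabulate (g ∘ suc))
    ... | false = length-filter-tabulate (g ∘ suc)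

-- Equinumerous colourings from partitions into classes of equal size

-- The first element satisfying P, or the last element if there is none.
least : ∀ {N p} {P : Pred (Fin (suc N)) p} → Decidable P → Fin (suc N)
least {zero} P? = zero
least {suc N} P? = if does (P? zero) then zero else suc (least (P? ∘ suc))

least-satisfies : ∀ {N p} {P : Pred (Fin (suc N)) p} (P? : Decidable P) {i} → P i → P (least P?)
least-satisfies {zero} P? {zero} Pi = Pi
least-satisfies {suc N} P? {i} Pi with P? zero
... | yes P0 = P0
... | no ¬P0 with i
...   | zero = ⊥-elim (¬P0 Pi)
...   | suc i = least-satisfies (P? ∘ suc) Pi

least-cong : ∀ {N p q} {P : Pred (Fin (suc N)) p} {Q : Pred (Fin (suc N)) q}
  (P? : Decidable P) (Q? : Decidable Q) → (∀ i → P i ⇔ Q i) → least P? ≡ least Q?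
least-cong {zero} P? Q? P⇔Q = refl
least-cong {suc N} P? Q? P⇔Q =
  cong₂ (λ b i → if b then zero else suc i)
        (does-⇔ (P⇔Q zero) (P? zero) (Q? zero)) (least-cong (P? ∘ suc) (Q? ∘ suc) (P⇔Q ∘ suc))

index-lookup : ∀ {a} {A : Set a} {xs : List A} {x : A} → Unique xs → (x∈xs : x ∈ xs) →
  ∀ {ℓ} → x ≡ lookup xs ℓ → index x∈xs ≡ ℓ
index-lookup _ (here refl) {zero} _ = refl
index-lookup (x∉xs ∷ _) (here refl) {suc ℓ} x≡ = ⊥-elim (All.lookup x∉xs (∈-lookup ℓ) x≡)
index-lookup (x∉xs ∷ _) (there x∈xs) {zero} refl = ⊥-elim (All.lookup x∉xs x∈xs refl)
index-lookup (_ ∷ unique) (there x∈xs) {suc ℓ} x≡ = cong suc (index-lookup unique x∈xs x≡)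

IsEquinumerous : ∀ {N} k n → (Fin N → Fin k) → Set
IsEquinumerous k n col = Surjective col × (∀ ℓ → classSize col ℓ ≡ n)

EquinumerousColouring : ∀ N n {ℓ} → Rel (Fin N) ℓ → Set ℓ
EquinumerousColouring N n R =
  ∃ λ k → N ≡ k * n × Σ (Fin N → Fin k) λ col → IsEquinumerous k n col × (∀ x y → R x y → col x ≡ col y)

-- Colour x by the position, in the list of class representatives, of the least element of its class.
module Representatives {N' ℓ} {_~_ : Rel (Fin (suc N')) ℓ} (~-isEquivalence : IsEquivalence _~_)
  (_~?_ : Binary.Decidable _~_) (n : ℕ) (class-size : ∀ x → count (λ y → does (x ~? y)) ≡ n) where

  open IsEquivalence ~-isEquivalence renaming (refl to ~-refl; sym to ~-sym; trans to ~-trans)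

  rep : Fin (suc N') → Fin (suc N')
  rep x = least (x ~?_)

  ~-rep : ∀ x → x ~ rep x
  ~-rep x = least-satisfies (x ~?_) ~-refl

  rep-resp : ∀ {x y} → x ~ y → rep x ≡ rep y
  rep-resp x~y = least-cong (_ ~?_) (_ ~?_) (λ z → mk⇔ (~-trans (~-sym x~y)) (~-trans x~y))

  rep-idempotent : ∀ x → rep (rep x) ≡ rep x
  rep-idempotent x = sym (rep-resp (~-rep x))

  reps : List (Fin (suc N'))
  reps = filter (λ r → rep r ≟ r) (allFin (suc N'))

  rep∈reps : ∀ x → rep x ∈ reps
  rep∈reps x = ∈-filter⁺ (λ r → rep r ≟ r) (∈-allFin (rep x)) (rep-idempotent x)

  rep-lookup : ∀ ℓ → rep (lookup reps ℓ) ≡ lookup reps ℓ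
  rep-lookup ℓ = proj₂ (∈-filter⁻ (λ r → rep r ≟ r) {xs = allFin (suc N')} (∈-lookup ℓ))

  k : ℕ
  k = length reps

  colour : Fin (suc N') → Fin k
  colour x = index (rep∈reps x)

  colour≡⇔ : ∀ x ℓ → colour x ≡ ℓ ⇔ lookup reps ℓ ~ x
  colour≡⇔ x ℓ = mk⇔
    (λ { refl → ~-sym (subst (x ~_) (lookup-index (rep∈reps x)) (~-rep x)) })
    (λ r~x → index-lookup (Unique.filter⁺ (λ r → rep r ≟ r) (Unique.allFin⁺ (suc N'))) (rep∈reps x)
               (trans (sym (rep-resp r~x)) (rep-lookup ℓ)))

  colour-resp : ∀ {x y} → x ~ y → colour x ≡ colour y
  colour-resp {x} {y} x~y =
    Equivalence.from (colour≡⇔ x (colour y)) (~-trans (Equivalence.to (colour≡⇔ y (colour y)) refl) (~-sym x~y))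

  fibre-size : ∀ ℓ → count (λ x → does (colour x ≟ ℓ)) ≡ n
  fibre-size ℓ =
    trans (count-cong (λ x → does-⇔ (colour≡⇔ x ℓ) (colour x ≟ ℓ) (lookup reps ℓ ~? x)))
          (class-size (lookup reps ℓ))

  size : suc N' ≡ k * n
  size = begin
    suc N'                                            ≡⟨ ∑-count-fibres colour ⟨
    sum (λ ℓ → count (λ x → does (colour x ≟ ℓ)))  ≡⟨ sum-cong-≗ fibre-size ⟩
    sum {k} (λ _ → n)                                 ≡⟨ ∑-const {k} n ⟩
    k * n                                             ∎
    where open ≡-Reasoning

  equinumerous : IsEquinumerous k n colour
  equinumerous =
    (λ ℓ → lookup reps ℓ , Equivalence.from (colour≡⇔ _ ℓ) ~-refl) ,
    (λ ℓ → trans (length-filter-allFin (λ x → colour x ≟ ℓ)) (fibre-size ℓ))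

partition-colouring : ∀ {N ℓ} {_~_ : Rel (Fin N) ℓ} → IsEquivalence _~_ → (_~?_ : Binary.Decidable _~_) →
  ∀ n → (∀ x → count (λ y → does (x ~? y)) ≡ n) → EquinumerousColouring N n _~_
partition-colouring {zero} _ _ n _ = 0 , refl , (λ ()) , ((λ ()) , (λ ())) , λ ()
partition-colouring {suc N'} ~-isEquivalence _~?_ n class-size =
  k , size , colour , equinumerous , λ _ _ → colour-resp
  where open Representatives ~-isEquivalence _~?_ n class-size

-- Orbits of a fixed-point-free map of prime order

fold-multiple : ∀ {a} {A : Set a} (f : A → A) {p} x → fold x f p ≡ x → ∀ t → fold x f (t * p) ≡ x
fold-multiple f x fᵖx≡x zero = refl
fold-multiple f {p} x fᵖx≡x (suc t) =
  trans (fold-+ x f p) (trans (cong (λ y → fold y f p) (fold-multiple f x fᵖx≡x t)) fᵖx≡x)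

fixed-by-periods : ∀ {a} {A : Set a} (f : A → A) {p q} z → fold z f p ≡ z → fold z f q ≡ z →
  ∀ a b → 1 + a * p ≡ b * q → f z ≡ z
fixed-by-periods f {p} {q} z fᵖz≡z fᑫz≡z a b 1+ap≡bq = begin
  f z                  ≡⟨ cong f (fold-multiple f z fᵖz≡z a) ⟨
  fold z f (1 + a * p) ≡⟨ cong (fold z f) 1+ap≡bq ⟩
  fold z f (b * q)     ≡⟨ fold-multiple f z fᑫz≡z b ⟩
  z                    ∎
  where open ≡-Reasoning

fixed-by-prime-period : ∀ {a} {A : Set a} (f : A → A) {j d} → Prime j → ∀ z →
  fold z f j ≡ z → fold z f d ≡ z → 0 < d → d < j → f z ≡ z
fixed-by-prime-period f j-prime z fʲz≡z fᵈz≡z 0<d d<j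
  with coprime-Bézout (prime⇒coprime j-prime {{>-nonZero 0<d}} d<j)
... | Bézout.+- a b 1+bd≡aj = fixed-by-periods f z fᵈz≡z fʲz≡z b a 1+bd≡aj
... | Bézout.-+ a b 1+aj≡bd = fixed-by-periods f z fʲz≡z fᵈz≡z a b 1+aj≡bd

module Orbits {N j} (f : Fin N → Fin N) (j-prime : Prime j)
  (fʲ≡id : ∀ x → fold x f j ≡ x) (fixed-point-free : ∀ x → f x ≢ x) where

  instance
    j-nonZero : NonZero j
    j-nonZero = prime⇒nonZero j-prime

  _~_ : Rel (Fin N) 0ℓ
  x ~ y = ∃ λ i → fold x f i ≡ y

  fold-return : ∀ x {y} i → fold x f i ≡ y → fold y f (pred j * i) ≡ x
  fold-return x i refl = begin
    fold (fold x f i) f (pred j * i) ≡⟨ fold-+ x f (pred j * i) ⟨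
    fold x f (pred j * i + i)        ≡⟨ cong (fold x f) (+-comm (pred j * i) i) ⟩
    fold x f (suc (pred j) * i)      ≡⟨ cong (λ n → fold x f (n * i)) (suc-pred j) ⟩
    fold x f (j * i)                 ≡⟨ cong (fold x f) (*-comm j i) ⟩
    fold x f (i * j)                 ≡⟨ fold-multiple f x (fʲ≡id x) i ⟩
    x                                ∎
    where open ≡-Reasoning

  ~-isEquivalence : IsEquivalence _~_
  ~-isEquivalence = record
    { refl = 0 , refl
    ; sym = λ {x} (i , fⁱx≡y) → pred j * i , fold-return x i fⁱx≡y
    ; trans = λ {x} (i , fⁱx≡y) (i' , fⁱ'y≡z) →
        i' + i , trans (fold-+ x f i') (trans (cong (λ y → fold y f i') fⁱx≡y) fⁱ'y≡z)
    }

  orbit : Fin N → Fin j → Fin N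
  orbit x i = fold x f (toℕ i)

  fold-mod : ∀ x i → fold x f i ≡ fold x f (i % j)
  fold-mod x i = begin
    fold x f i                               ≡⟨ cong (fold x f) (m≡m%n+[m/n]*n i j) ⟩
    fold x f (i % j + (i / j) * j)           ≡⟨ fold-+ x f (i % j) ⟩
    fold (fold x f ((i / j) * j)) f (i % j)  ≡⟨ cong (λ y → fold y f (i % j)) (fold-multiple f x (fʲ≡id x) (i / j)) ⟩
    fold x f (i % j)                         ∎
    where open ≡-Reasoning

  ∈orbit⇔~ : ∀ {x y} → (∃ λ i → orbit x i ≡ y) ⇔ x ~ y
  ∈orbit⇔~ {x} = mk⇔
    (λ (i , e) → toℕ i , e)
    (λ (i , fⁱx≡y) → fromℕ< (m%n<n i j) ,
       trans (cong (fold x f) (toℕ-fromℕ< (m%n<n i j))) (trans (sym (fold-mod x i)) fⁱx≡y))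

  _~?_ : Binary.Decidable _~_
  x ~? y = Dec.map ∈orbit⇔~ (image? (orbit x) y)

  no-short-period : ∀ x {a b} → a < b → b < j → fold x f a ≢ fold x f b
  no-short-period x {a} {b} a<b b<j fᵃx≡fᵇx = fixed-point-free z
      (fixed-by-prime-period f j-prime z (fʲ≡id z) fᵈz≡z (m<n⇒0<n∸m a<b) (≤-<-trans (m∸n≤m b a) b<j))
    where
      z = fold x f a
      fᵈz≡z : fold z f (b ∸ a) ≡ z
      fᵈz≡z = begin
        fold z f (b ∸ a)       ≡⟨ fold-+ x f (b ∸ a) ⟨
        fold x f (b ∸ a + a)   ≡⟨ cong (fold x f) (m∸n+n≡m (<⇒≤ a<b)) ⟩
        fold x f b             ≡⟨ fᵃx≡fᵇx ⟨
        z                      ∎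
        where open ≡-Reasoning

  orbit-injective : ∀ x → Injective _≡_ _≡_ (orbit x)
  orbit-injective x {a} {b} e with ℕ.<-cmp (toℕ a) (toℕ b)
  ... | tri< a<b _ _ = ⊥-elim (no-short-period x a<b (toℕ<n b) e)
  ... | tri≈ _ a≡b _ = toℕ-injective a≡b
  ... | tri> _ _ b<a = ⊥-elim (no-short-period x b<a (toℕ<n a) (sym e))

  orbit-size : ∀ x → count (λ y → does (x ~? y)) ≡ j
  orbit-size x = count-image (orbit x) (orbit-injective x)

  orbit-colouring : ∀ {ℓ} (R : Rel (Fin N) ℓ) → (∀ x y → R x y → f x ≡ y) → EquinumerousColouring N j R
  orbit-colouring R R⇒f with partition-colouring ~-isEquivalence _~?_ j orbit-size
  ... | k , N≡kj , col , equinumerous , col-resp =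
    k , N≡kj , col , equinumerous , λ x y Rxy → col-resp x y (1 , R⇒f x y Rxy)

∣! : ∀ {p T} .{{_ : NonZero p}} → p ≤ T → p ∣ T !
∣! {suc p} p≤T = ∣-trans (m∣m*n (p !)) (m≤n⇒m!∣n! p≤T)

-- Euclid: every prime factor of T! + 1 exceeds T.
∃-prime> : ∀ T → ∃ λ p → Prime p × T < p
∃-prime> T = larger-factor (factors F) (isFactorisation F) (factorsPrime F)
  where
    open PrimeFactorisation
    F = factorise (suc (T !))
    larger-factor : ∀ ps → suc (T !) ≡ product ps → All.All Prime ps → ∃ λ p → Prime p × T < p
    larger-factor [] T!+1≡1 _ = ⊥-elim (≢-nonZero⁻¹ (T !) {{T ℕ.!≢0}} (ℕ.suc-injective T!+1≡1))
    larger-factor (p ∷ ps) T!+1≡p*∏ (p-prime All.∷ _) with T ℕ.<? p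
    ... | yes T<p = p , p-prime , T<p
    ... | no T≮p = ⊥-elim (¬prime[1] (subst Prime p≡1 p-prime))
      where
        p∣T!+1 : p ∣ suc (T !)
        p∣T!+1 = subst (p ∣_) (sym T!+1≡p*∏) (m∣m*n (product ps))
        p≡1 : p ≡ 1
        p≡1 = ∣1⇒≡1 (∣m+n∣m⇒∣n (subst (p ∣_) (+-comm 1 (T !)) p∣T!+1)
                               (∣! {{prime⇒nonZero p-prime}} (ℕ.≮⇒≥ T≮p)))

square≤2^ : ∀ d → (4 + d) * (4 + d) ≤ 2 ^ (4 + d)
square≤2^ zero = ℕ.≤-refl
square≤2^ (suc d) = ℕ.≤-trans (ℕ.m≤m+n ((5 + d) * (5 + d)) (7 + 6 * d + d * d))
                     (ℕ.≤-trans (ℕ.≤-reflexive (expand d)) (ℕ.*-monoʳ-≤ 2 (square≤2^ d)))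
  where
    expand : ∀ d → (5 + d) * (5 + d) + (7 + 6 * d + d * d) ≡ 2 * ((4 + d) * (4 + d))
    expand = solve-∀

linear≤2^ : ∀ K n → K + 4 ≤ n → K * suc n + 2 ≤ 2 ^ n
linear≤2^ K n K+4≤n = subst (λ n → K * suc n + 2 ≤ 2 ^ n) (m+[n∸m]≡n K+4≤n) (begin
  K * suc (K + 4 + e) + 2        ≤⟨ ℕ.m≤m+n _ (3 * K + K * e + e * e + 8 * e + 14) ⟩
  K * suc (K + 4 + e) + 2 + (3 * K + K * e + e * e + 8 * e + 14)
                                  ≡⟨ expand K e ⟩
  (4 + (K + e)) * (4 + (K + e))  ≤⟨ square≤2^ (K + e) ⟩
  2 ^ (4 + (K + e))              ≡⟨ cong (2 ^_) (regroup K e) ⟩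
  2 ^ (K + 4 + e)                ∎)
  where
    open ℕ.≤-Reasoning
    e = n ∸ (K + 4)
    expand : ∀ K e → K * suc (K + 4 + e) + 2 + (3 * K + K * e + e * e + 8 * e + 14) ≡ (4 + (K + e)) * (4 + (K + e))
    expand = solve-∀
    regroup : ∀ K e → 4 + (K + e) ≡ K + 4 + e
    regroup = solve-∀

coprime-^ : ∀ {a b} → Coprime a b → ∀ i → Coprime a (b ^ i)
coprime-^ a⊥b zero (_ , d∣1) = ∣1⇒≡1 d∣1
coprime-^ a⊥b (suc i) (d∣a , d∣b*bⁱ) = coprime-^ a⊥b i (d∣a , coprime-divisor d⊥b d∣b*bⁱ)
  where
    d⊥b : Coprime _ _
    d⊥b (e∣d , e∣b) = a⊥b (∣-trans e∣d d∣a , e∣b)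

-- geom P Q i = Σ_{a+b=i-1} P^a Q^b, i.e. (P^i - Q^i)/(P - Q) when P ≠ Q.
geom : ℕ → ℕ → ℕ → ℕ
geom P Q zero = 0
geom P Q (suc i) = P ^ i + Q * geom P Q i

^-difference : ∀ Q D i → Q ^ i + D * geom (Q + D) Q i ≡ (Q + D) ^ i
^-difference Q D zero = cong suc (ℕ.*-zeroʳ D)
^-difference Q D (suc i) = begin
  Q * Q ^ i + D * (P ^ i + Q * g)  ≡⟨ regroup Q D (Q ^ i) g (P ^ i) ⟩
  Q * (Q ^ i + D * g) + D * P ^ i  ≡⟨ cong (λ x → Q * x + D * P ^ i) (^-difference Q D i) ⟩
  Q * P ^ i + D * P ^ i            ≡⟨ ℕ.*-distribʳ-+ (P ^ i) Q D ⟨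
  P * P ^ i                        ∎
  where
    open ≡-Reasoning
    P = Q + D
    g = geom P Q i
    regroup : ∀ Q D q g p → Q * q + D * (p + Q * g) ≡ Q * (q + D * g) + D * p
    regroup = solve-∀

^≤geom : ∀ P Q i → P ^ i ≤ geom P Q (suc i)
^≤geom P Q i = ℕ.m≤m+n (P ^ i) (Q * geom P Q i)

coprime-geom : ∀ {P Q} → Coprime P Q → ∀ i → Coprime Q (geom P Q (suc i))
coprime-geom {P} {Q} P⊥Q i {d} (d∣Q , d∣geom) = coprime-^ (Coprime.sym P⊥Q) i (d∣Q , d∣Pⁱ)
  where
    d∣Pⁱ : d ∣ P ^ i
    d∣Pⁱ = ∣m+n∣m⇒∣n (subst (d ∣_) (+-comm (P ^ i) (Q * geom P Q i)) d∣geom) (∣m⇒∣m*n (geom P Q i) d∣Q)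

linear≤geom : ∀ {Q D} K j → 0 < Q → 0 < D → K + 5 ≤ j → K * j + 2 ≤ geom (Q + D) Q j
linear≤geom K zero _ _ K+5≤0 = ⊥-elim (ℕ.m+1+n≢0 K (ℕ.n≤0⇒n≡0 K+5≤0))
linear≤geom {Q} {D} K (suc n) 0<Q 0<D K+5≤j = begin
  K * suc n + 2     ≤⟨ linear≤2^ K n (ℕ.≤-pred (subst (_≤ suc n) (ℕ.+-suc K 4) K+5≤j)) ⟩
  2 ^ n             ≤⟨ ℕ.^-monoˡ-≤ n (ℕ.+-mono-≤ 0<Q 0<D) ⟩
  (Q + D) ^ n       ≤⟨ ^≤geom (Q + D) Q n ⟩
  geom (Q + D) Q (suc n) ∎
  where open ℕ.≤-Reasoning

geom-mod : ∀ Q D i → ∃ λ t → geom (Q + D) Q (suc i) ≡ suc i * Q ^ i + D * t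
geom-mod Q D zero = 0 , cong suc (trans (ℕ.*-zeroʳ Q) (sym (ℕ.*-zeroʳ D)))
geom-mod Q D (suc i) with geom-mod Q D i
... | t , e = geom P Q (suc i) + Q * t , (begin
  P ^ suc i + Q * geom P Q (suc i)
    ≡⟨ cong₂ (λ x y → x + Q * y) (^-difference Q D (suc i)) (sym e) ⟨
  Q ^ suc i + D * geom P Q (suc i) + Q * (suc i * Q ^ i + D * t)
    ≡⟨ regroup Q D (Q ^ i) (geom P Q (suc i)) t i ⟩
  suc (suc i) * (Q * Q ^ i) + D * (geom P Q (suc i) + Q * t)
    ∎)
  where
    open ≡-Reasoning
    P = Q + D
    regroup : ∀ Q D q g t i → Q * q + D * g + Q * (suc i * q + D * t) ≡ suc (suc i) * (Q * q) + D * (g + Q * t)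
    regroup = solve-∀

-- Modulo D, geom (Q + D) Q (suc i) ≡ suc i * Q ^ i, and Q is coprime to D.
common-divisor∣exponent : ∀ {Q D d} i → Coprime (Q + D) Q →
  d ∣ geom (Q + D) Q (suc i) → d ∣ D → d ∣ suc i
common-divisor∣exponent {Q} {D} {d} i P⊥Q d∣geom d∣D with geom-mod Q D i
... | t , geom≡ = coprime-divisor (coprime-^ d⊥Q i) (subst (d ∣_) (ℕ.*-comm (suc i) (Q ^ i)) d∣jQⁱ)
  where
    d∣jQⁱ : d ∣ suc i * Q ^ i
    d∣jQⁱ = ∣m+n∣m⇒∣n (subst (d ∣_) (trans geom≡ (+-comm _ (D * t))) d∣geom) (∣m⇒∣m*n t d∣D)
    d⊥Q : Coprime d Q
    d⊥Q (e∣d , e∣Q) = P⊥Q (∣m∣n⇒∣m+n e∣Q (∣-trans e∣d d∣D) , e∣Q)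

geom⊥difference : ∀ {Q D} j → Prime j → 0 < D → D < j → Coprime (Q + D) Q → Coprime (geom (Q + D) Q j) D
geom⊥difference zero j-prime = ⊥-elim (¬prime[0] j-prime)
geom⊥difference (suc i) j-prime 0<D D<j P⊥Q (d∣geom , d∣D)
  with prime⇒irreducible j-prime (common-divisor∣exponent i P⊥Q d∣geom d∣D)
... | inj₁ d≡1 = d≡1
... | inj₂ refl = ⊥-elim (ℕ.<⇒≱ D<j (∣⇒≤ {{>-nonZero 0<D}} d∣D))

^-distribʳ-* : ∀ a b i → (a * b) ^ i ≡ a ^ i * b ^ i
^-distribʳ-* a b zero = refl
^-distribʳ-* a b (suc i) = trans (cong (a * b *_) (^-distribʳ-* a b i)) (interchange a b (a ^ i) (b ^ i))
  where
    interchange : ∀ a b x y → a * b * (x * y) ≡ a * x * (b * y)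
    interchange = solve-∀

-- Congruences and the map v ↦ P v Q⁻¹ modulo m

module _ {m} .{{_ : NonZero m}} where

  %-cong-*ʳ : ∀ {a b} c → a % m ≡ b % m → (a * c) % m ≡ (b * c) % m
  %-cong-*ʳ {a} {b} c a≡b = begin
    (a * c) % m              ≡⟨ %-distribˡ-* a c m ⟩
    (a % m * (c % m)) % m    ≡⟨ cong (λ x → (x * (c % m)) % m) a≡b ⟩
    (b % m * (c % m)) % m    ≡⟨ %-distribˡ-* b c m ⟨
    (b * c) % m              ∎
    where open ≡-Reasoning

  %-cong-*ˡ : ∀ {a b} c → a % m ≡ b % m → (c * a) % m ≡ (c * b) % m
  %-cong-*ˡ {a} {b} c a≡b = begin
    (c * a) % m ≡⟨ cong (_% m) (*-comm c a) ⟩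
    (a * c) % m ≡⟨ %-cong-*ʳ c a≡b ⟩
    (b * c) % m ≡⟨ cong (_% m) (*-comm b c) ⟩
    (c * b) % m ∎
    where open ≡-Reasoning

  %-cong-^ : ∀ {a b} i → a % m ≡ b % m → (a ^ i) % m ≡ (b ^ i) % m
  %-cong-^ zero a≡b = refl
  %-cong-^ {a} {b} (suc i) a≡b = trans (%-cong-*ʳ (a ^ i) a≡b) (%-cong-*ˡ b (%-cong-^ i a≡b))

  %≡⇒∣∸ : ∀ {a b} → a % m ≡ b % m → m ∣ a ∸ b
  %≡⇒∣∸ {a} {b} a≡b = divides (a / m ∸ b / m) (begin
    a ∸ b                                      ≡⟨ cong₂ _∸_ (m≡m%n+[m/n]*n a m) (m≡m%n+[m/n]*n b m) ⟩
    (a % m + a / m * m) ∸ (b % m + b / m * m)  ≡⟨ cong (λ x → (a % m + a / m * m) ∸ (x + b / m * m)) a≡b ⟨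
    (a % m + a / m * m) ∸ (a % m + b / m * m)  ≡⟨ ℕ.[m+n]∸[m+o]≡n∸o (a % m) _ _ ⟩
    a / m * m ∸ b / m * m                      ≡⟨ ℕ.*-distribʳ-∸ m (a / m) (b / m) ⟨
    (a / m ∸ b / m) * m                        ∎)
    where open ≡-Reasoning

-- In the second Bézout case 1 + x a is a multiple of n + 1, so the inverse is -x ≡ x n.
inverse-mod : ∀ {a n} → Coprime a (suc n) → ∃ λ b → (a * b) % suc n ≡ 1 % suc n
inverse-mod {a} {n} a⊥m with coprime-Bézout a⊥m
... | Bézout.+- x y 1+ym≡xa = x , (begin
  (a * x) % suc n           ≡⟨ cong (_% suc n) (trans (*-comm a x) (sym 1+ym≡xa)) ⟩
  (1 + y * suc n) % suc n   ≡⟨ [m+kn]%n≡m%n 1 y (suc n) ⟩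
  1 % suc n                 ∎)
  where open ≡-Reasoning
... | Bézout.-+ x y 1+xa≡ym = x * n , (begin
  (a * (x * n)) % suc n                 ≡⟨ cong (_% suc n) (reorder a x n) ⟩
  (x * a * n) % suc n                   ≡⟨ [m+kn]%n≡m%n (x * a * n) y (suc n) ⟨
  (x * a * n + y * suc n) % suc n       ≡⟨ cong (λ z → (x * a * n + z) % suc n) 1+xa≡ym ⟨
  (x * a * n + (1 + x * a)) % suc n     ≡⟨ cong (_% suc n) (collect (x * a) n) ⟩
  (1 + x * a * suc n) % suc n           ≡⟨ [m+kn]%n≡m%n 1 (x * a) (suc n) ⟩
  1 % suc n                             ∎)
  where
    open ≡-Reasoning
    reorder : ∀ a x n → a * (x * n) ≡ x * a * n
    reorder = solve-∀
    collect : ∀ t n → t * n + (1 + t) ≡ 1 + t * suc n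
    collect = solve-∀

elem-injective : ∀ {N} → Injective _≡_ _≡_ (elem {N})
elem-injective = toℕ-injective ∘ ℕ.suc-injective

fromElem : ∀ {N} v → 0 < v → v ≤ N → Fin N
fromElem (suc v) _ v<N = fromℕ< v<N

elem-fromElem : ∀ {N} v (0<v : 0 < v) (v≤N : v ≤ N) → elem (fromElem v 0<v v≤N) ≡ v
elem-fromElem (suc v) _ v<N = cong suc (toℕ-fromℕ< v<N)

elem-fold : ∀ {N} {f : Fin N → Fin N} {ψ : ℕ → ℕ} → (∀ x → elem (f x) ≡ ψ (elem x)) →
  ∀ x i → elem (fold x f i) ≡ fold (elem x) ψ i
elem-fold f≈ψ x zero = refl
elem-fold {f = f} {ψ} f≈ψ x (suc i) = trans (f≈ψ (fold x f i)) (cong ψ (elem-fold f≈ψ x i))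

-- ψ is multiplication by P/Q modulo m = N + 1, and f is its restriction to [N] = {1, …, N}.
module ModularMap (N : ℕ) {Q D Qi j : ℕ} (Q*Qi≡1 : (Q * Qi) % suc N ≡ 1 % suc N)
  (Pʲ≡Qʲ : ((Q + D) ^ j) % suc N ≡ (Q ^ j) % suc N) (m⊥D : Coprime (suc N) D) (0<j : 0 < j) where

  m P : ℕ
  m = suc N
  P = Q + D

  ψ : ℕ → ℕ
  ψ v = (P * v * Qi) % m

  ψ<m : ∀ v → ψ v < m
  ψ<m v = m%n<n (P * v * Qi) m

  ψ-iterate : ∀ v i → fold v ψ i % m ≡ ((P * Qi) ^ i * v) % m
  ψ-iterate v zero = cong (_% m) (sym (ℕ.*-identityˡ v))
  ψ-iterate v (suc i) = begin
    (P * w * Qi) % m % m                ≡⟨ m%n%n≡m%n (P * w * Qi) m ⟩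
    (P * w * Qi) % m                    ≡⟨ cong (_% m) (swap P w Qi) ⟩
    (P * Qi * w) % m                    ≡⟨ %-cong-*ˡ {a = w} {(P * Qi) ^ i * v} (P * Qi) (ψ-iterate v i) ⟩
    (P * Qi * ((P * Qi) ^ i * v)) % m   ≡⟨ cong (_% m) (ℕ.*-assoc (P * Qi) _ v) ⟨
    ((P * Qi) ^ suc i * v) % m          ∎
    where
      open ≡-Reasoning
      w = fold v ψ i
      swap : ∀ p w q → p * w * q ≡ p * q * w
      swap = solve-∀

  ratio-order : ((P * Qi) ^ j) % m ≡ 1 % m
  ratio-order = begin
    ((P * Qi) ^ j) % m       ≡⟨ cong (_% m) (^-distribʳ-* P Qi j) ⟩
    (P ^ j * Qi ^ j) % m     ≡⟨ %-cong-*ʳ {a = P ^ j} {Q ^ j} (Qi ^ j) Pʲ≡Qʲ ⟩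
    (Q ^ j * Qi ^ j) % m     ≡⟨ cong (_% m) (^-distribʳ-* Q Qi j) ⟨
    ((Q * Qi) ^ j) % m       ≡⟨ %-cong-^ {a = Q * Qi} {1} j Q*Qi≡1 ⟩
    (1 ^ j) % m              ≡⟨ cong (_% m) (ℕ.^-zeroˡ j) ⟩
    1 % m                    ∎
    where open ≡-Reasoning

  fold<m : ∀ v {i} → 0 < i → fold v ψ i < m
  fold<m v {suc i} _ = ψ<m (fold v ψ i)

  ψ-period : ∀ v → v < m → fold v ψ j ≡ v
  ψ-period v v<m = begin
    fold v ψ j               ≡⟨ m<n⇒m%n≡m (fold<m v 0<j) ⟨
    fold v ψ j % m           ≡⟨ ψ-iterate v j ⟩
    ((P * Qi) ^ j * v) % m   ≡⟨ %-cong-*ʳ {a = (P * Qi) ^ j} {1} v ratio-order ⟩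
    (1 * v) % m              ≡⟨ cong (_% m) (ℕ.*-identityˡ v) ⟩
    v % m                    ≡⟨ m<n⇒m%n≡m v<m ⟩
    v                        ∎
    where open ≡-Reasoning

  ψ-solution : ∀ x y → P * x ≡ Q * y → y < m → ψ x ≡ y
  ψ-solution x y Px≡Qy y<m = begin
    (P * x * Qi) % m      ≡⟨ cong (λ z → (z * Qi) % m) Px≡Qy ⟩
    (Q * y * Qi) % m      ≡⟨ cong (_% m) (reorder Q y Qi) ⟩
    (y * (Q * Qi)) % m    ≡⟨ %-cong-*ˡ {a = Q * Qi} {1} y Q*Qi≡1 ⟩
    (y * 1) % m           ≡⟨ cong (_% m) (ℕ.*-identityʳ y) ⟩
    y % m                 ≡⟨ m<n⇒m%n≡m y<m ⟩
    y                     ∎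
    where
      open ≡-Reasoning
      reorder : ∀ q y r → q * y * r ≡ y * (q * r)
      reorder = solve-∀

  ψ-not-fixed : ∀ v → 0 < v → v < m → ψ v ≢ v
  ψ-not-fixed v 0<v v<m ψv≡v = ℕ.<⇒≱ v<m (∣⇒≤ {{>-nonZero 0<v}} m∣v)
    where
      open ≡-Reasoning
      1≡Qi*Q : 1 % m ≡ (Qi * Q) % m
      1≡Qi*Q = trans (sym Q*Qi≡1) (cong (_% m) (*-comm Q Qi))
      Pv≡Qv : (P * v) % m ≡ (Q * v) % m
      Pv≡Qv = begin
        (P * v) % m              ≡⟨ cong (_% m) (ℕ.*-identityʳ (P * v)) ⟨
        (P * v * 1) % m          ≡⟨ %-cong-*ˡ {a = 1} {Qi * Q} (P * v) 1≡Qi*Q ⟩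
        (P * v * (Qi * Q)) % m   ≡⟨ cong (_% m) (ℕ.*-assoc (P * v) Qi Q) ⟨
        (P * v * Qi * Q) % m     ≡⟨ %-cong-*ʳ {a = P * v * Qi} {v} Q (trans ψv≡v (sym (m<n⇒m%n≡m v<m))) ⟩
        (v * Q) % m              ≡⟨ cong (_% m) (*-comm v Q) ⟩
        (Q * v) % m              ∎
      Pv∸Qv≡Dv : P * v ∸ Q * v ≡ D * v
      Pv∸Qv≡Dv = trans (cong (_∸ Q * v) (ℕ.*-distribʳ-+ v Q D)) (ℕ.m+n∸m≡n (Q * v) (D * v))
      m∣v : m ∣ v
      m∣v = coprime-divisor m⊥D (subst (m ∣_) Pv∸Qv≡Dv (%≡⇒∣∸ {a = P * v} {Q * v} Pv≡Qv))

  fold-0 : ∀ i → fold 0 ψ i ≡ 0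
  fold-0 zero = refl
  fold-0 (suc i) = trans (cong ψ (fold-0 i)) (cong (λ x → (x * Qi) % m) (ℕ.*-zeroʳ P))

  ψ-positive : ∀ v → 0 < v → v < m → 0 < ψ v
  ψ-positive v 0<v v<m = ℕ.n≢0⇒n>0 λ ψv≡0 → ℕ.<⇒≢ 0<v (sym (begin
    v                         ≡⟨ ψ-period v v<m ⟨
    fold v ψ j                ≡⟨ cong (fold v ψ) (suc-pred j {{>-nonZero 0<j}}) ⟨
    fold v ψ (suc (pred j))   ≡⟨ iterate-is-fold v ψ (suc (pred j)) ⟩
    iterate ψ (ψ v) (pred j)  ≡⟨ iterate-is-fold (ψ v) ψ (pred j) ⟨
    fold (ψ v) ψ (pred j)     ≡⟨ cong (λ x → fold x ψ (pred j)) ψv≡0 ⟩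
    fold 0 ψ (pred j)         ≡⟨ fold-0 (pred j) ⟩
    0                         ∎))
    where open ≡-Reasoning

  elem<m : ∀ (x : Fin N) → elem x < m
  elem<m x = s≤s (toℕ<n x)

  f : Fin N → Fin N
  f x = fromElem (ψ (elem x)) (ψ-positive (elem x) (s≤s z≤n) (elem<m x)) (s≤s⁻¹ (ψ<m (elem x)))

  f≈ψ : ∀ x → elem (f x) ≡ ψ (elem x)
  f≈ψ x = elem-fromElem _ _ _

  f-period : ∀ x → fold x f j ≡ x
  f-period x = elem-injective (trans (elem-fold f≈ψ x j) (ψ-period (elem x) (elem<m x)))

  f-fixed-point-free : ∀ x → f x ≢ x
  f-fixed-point-free x fx≡x = ψ-not-fixed (elem x) (s≤s z≤n) (elem<m x) (trans (sym (f≈ψ x)) (cong elem fx≡x))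

  f-solution : ∀ x y → P * elem x ≡ Q * elem y → f x ≡ y
  f-solution x y Px≡Qy = elem-injective (trans (f≈ψ x) (ψ-solution (elem x) (elem y) Px≡Qy (elem<m y)))

-- Colourings that block the solutions of P x = Q y

BlockingColouring : (ℕ → ℕ → Set) → ℕ → Set
BlockingColouring R K = ∃ λ k → K ≤ k × ∃ λ n → 1 ≤ n × Σ (Fin (k * n) → Fin k) λ c →
  Equinumerous k n c × (∀ x y → R (elem x) (elem y) → c x ≡ c y)

blocking-colouring : ∀ {R} K {N n} → 0 < n → K * n < N →
  EquinumerousColouring N n (λ x y → R (elem x) (elem y)) → BlockingColouring R K
blocking-colouring K {n = n} 0<n Kn<N (k , refl , col , equinumerous , col-resp) =
  k , <⇒≤ (ℕ.*-cancelʳ-< n K k Kn<N) , n , 0<n , col , equinumerous , col-resp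

identity-colouring : ∀ R K → (∀ a b → R (suc a) (suc b) → a ≡ b) → BlockingColouring R K
identity-colouring R K R⇒≡ =
  blocking-colouring {R} K (s≤s z≤n) (subst (_< suc K) (sym (*-identityʳ K)) ℕ.≤-refl)
  (suc K , sym (*-identityʳ (suc K)) , id ,
   ((λ ℓ → ℓ , refl) , λ ℓ → trans (length-filter-allFin (_≟ ℓ)) (count-≟ʳ ℓ)) ,
   λ x y Rxy → toℕ-injective (R⇒≡ _ _ Rxy))

blocking-⇒ : ∀ {R S K} → (∀ {a b} → R a b → S a b) → BlockingColouring S K → BlockingColouring R K
blocking-⇒ R⇒S (k , K≤k , n , 1≤n , c , equinumerous , blocks) =
  k , K≤k , n , 1≤n , c , equinumerous , λ x y Rxy → blocks x y (R⇒S Rxy)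

blocking-flip : ∀ {R K} → BlockingColouring (λ a b → R b a) K → BlockingColouring R K
blocking-flip (k , K≤k , n , 1≤n , c , equinumerous , blocks) =
  k , K≤k , n , 1≤n , c , equinumerous , λ x y Rxy → sym (blocks y x Rxy)

geometric-colouring : ∀ {Q D j} N → Prime j → 0 < D → D < j → Coprime (Q + D) Q → geom (Q + D) Q j ≡ suc N →
  EquinumerousColouring N j (λ x y → (Q + D) * elem x ≡ Q * elem y)
geometric-colouring {j = zero} N j-prime = ⊥-elim (¬prime[0] j-prime)
geometric-colouring {Q} {D} {j@(suc i)} N j-prime 0<D D<j P⊥Q m≡sucN =
  orbit-colouring (λ x y → (Q + D) * elem x ≡ Q * elem y) f-solution
  where
    Q⊥m : Coprime Q (suc N)
    Q⊥m = subst (Coprime Q) m≡sucN (coprime-geom P⊥Q i)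
    Pʲ≡Qʲ : ((Q + D) ^ j) % suc N ≡ (Q ^ j) % suc N
    Pʲ≡Qʲ = trans (cong (_% suc N) (trans (sym (^-difference Q D j)) (cong (λ m → Q ^ j + D * m) m≡sucN)))
                  ([m+kn]%n≡m%n (Q ^ j) D (suc N))
    m⊥D : Coprime (suc N) D
    m⊥D = subst (λ m → Coprime m D) m≡sucN (geom⊥difference j j-prime 0<D D<j P⊥Q)
    open ModularMap N {Q} {D} {j = j} (proj₂ (inverse-mod Q⊥m)) Pʲ≡Qʲ m⊥D (s≤s z≤n)
    open Orbits f j-prime f-period f-fixed-point-free

coprime-colouring : ∀ {P Q} K → 0 < Q → Q < P → Coprime P Q →
  BlockingColouring (λ a b → P * a ≡ Q * b) K
coprime-colouring {P} {Q} K 0<Q Q<P P⊥Q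
  with P ∸ Q | m<n⇒0<n∸m Q<P | m+[n∸m]≡n (<⇒≤ Q<P)
... | D | 0<D | refl with ∃-prime> (D + (K + 4))
... | j , j-prime , D+K+4<j =
  blocking-colouring {λ a b → (Q + D) * a ≡ Q * b} K (>-nonZero⁻¹ j {{prime⇒nonZero j-prime}}) Kj<N
    (geometric-colouring N j-prime 0<D D<j P⊥Q m≡sucN)
  where
    m N : ℕ
    m = geom (Q + D) Q j
    N = pred m
    D<j : D < j
    D<j = ℕ.≤-<-trans (ℕ.m≤m+n D (K + 4)) D+K+4<j
    K+5≤j : K + 5 ≤ j
    K+5≤j = ℕ.≤-trans (subst (_≤ suc (D + (K + 4))) (sym (ℕ.+-suc K 4)) (s≤s (ℕ.m≤n+m (K + 4) D))) D+K+4<j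
    Kj+2≤m : K * j + 2 ≤ m
    Kj+2≤m = linear≤geom K j 0<Q 0<D K+5≤j
    m≡sucN : m ≡ suc N
    m≡sucN = sym (suc-pred m {{>-nonZero (ℕ.≤-trans (s≤s z≤n) (ℕ.≤-trans (ℕ.m≤n+m 2 (K * j)) Kj+2≤m))}})
    Kj<N : K * j < N
    Kj<N = ℕ.≤-pred (subst (suc (suc (K * j)) ≤_) m≡sucN (subst (_≤ m) (+-comm (K * j) 2) Kj+2≤m))

coprime-line-colouring : ∀ {P Q} K → 0 < P → 0 < Q → P ≢ Q → Coprime P Q →
  BlockingColouring (λ a b → P * a ≡ Q * b) K
coprime-line-colouring {P} {Q} K 0<P 0<Q P≢Q P⊥Q with ℕ.<-cmp P Q
... | tri≈ _ P≡Q _ = ⊥-elim (P≢Q P≡Q)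
... | tri> _ _ Q<P = coprime-colouring K 0<Q Q<P P⊥Q
... | tri< P<Q _ _ = blocking-flip {λ a b → P * a ≡ Q * b}
  (blocking-⇒ {S = λ a b → Q * a ≡ P * b} sym (coprime-colouring K 0<P P<Q (Coprime.sym P⊥Q)))

gcd-line-colouring : ∀ {P Q} K → P ≢ 0 → Q ≢ 0 → P ≢ Q → BlockingColouring (λ a b → P * a ≡ Q * b) K
gcd-line-colouring {P} {Q} K P≢0 Q≢0 P≢Q =
  blocking-⇒ {S = λ a b → P' * a ≡ Q' * b} divide
    (coprime-line-colouring K (positive P'g≡P P≢0) (positive Q'g≡Q Q≢0) P'≢Q' (coprime-/gcd P Q))
  where
    g P' Q' : ℕ
    g = gcd P Q
    instance
      g≢0 : NonZero g
      g≢0 = ≢-nonZero (gcd[m,n]≢0 P Q (inj₁ P≢0))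
    P' = P / g
    Q' = Q / g
    P'g≡P : P' * g ≡ P
    P'g≡P = m/n*n≡m (gcd[m,n]∣m P Q)
    Q'g≡Q : Q' * g ≡ Q
    Q'g≡Q = m/n*n≡m (gcd[m,n]∣n P Q)
    positive : ∀ {R R'} → R' * g ≡ R → R ≢ 0 → 0 < R'
    positive {R' = R'} R'g≡R R≢0 = ℕ.n≢0⇒n>0 λ R'≡0 → R≢0 (trans (sym R'g≡R) (cong (_* g) R'≡0))
    P'≢Q' : P' ≢ Q'
    P'≢Q' P'≡Q' = P≢Q (trans (sym P'g≡P) (trans (cong (_* g) P'≡Q') Q'g≡Q))
    divide : ∀ {a b} → P * a ≡ Q * b → P' * a ≡ Q' * b
    divide {a} {b} Pa≡Qb = ℕ.*-cancelˡ-≡ (P' * a) (Q' * b) g (begin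
      g * (P' * a)  ≡⟨ regroup g P' a ⟩
      P' * g * a    ≡⟨ cong (_* a) P'g≡P ⟩
      P * a         ≡⟨ Pa≡Qb ⟩
      Q * b         ≡⟨ cong (_* b) Q'g≡Q ⟨
      Q' * g * b    ≡⟨ regroup g Q' b ⟨
      g * (Q' * b)  ∎)
      where
        open ≡-Reasoning
        regroup : ∀ g c x → g * (c * x) ≡ c * g * x
        regroup = solve-∀

line-colouring : ∀ {P Q} K → ¬ (P ≡ 0 × Q ≡ 0) → BlockingColouring (λ a b → P * a ≡ Q * b) K
line-colouring {P} {Q} K not-both-0 with P ℕ.≟ 0 | Q ℕ.≟ 0 | P ℕ.≟ Q
... | yes P≡0 | yes Q≡0 | _ = ⊥-elim (not-both-0 (P≡0 , Q≡0))
... | yes refl | no Q≢0 | _ = identity-colouring (λ a b → 0 * a ≡ Q * b) K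
  λ a b 0≡Qb → ⊥-elim (Q≢0 (ℕ.m*n≡0⇒m≡0 Q (suc b) (sym 0≡Qb)))
... | no P≢0 | yes refl | _ = identity-colouring (λ a b → P * a ≡ 0 * b) K
  λ a b Pa≡0 → ⊥-elim (P≢0 (ℕ.m*n≡0⇒m≡0 P (suc a) Pa≡0))
... | no P≢0 | no _ | yes refl =
  identity-colouring (λ a b → P * a ≡ P * b) K
  λ a b Pa≡Pb → ℕ.suc-injective (ℕ.*-cancelˡ-≡ (suc a) (suc b) P {{≢-nonZero P≢0}} Pa≡Pb)
... | no P≢0 | no Q≢0 | no P≢Q = gcd-line-colouring K P≢0 Q≢0 P≢Q

-- The kernel of a 1 × 2 rational matrix

abs-relation : ∀ u v x y → u ℤ.* ℤ.+ x ℤ.+ v ℤ.* ℤ.+ y ≡ 0ℤ → ∣ u ∣ * x ≡ ∣ v ∣ * y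
abs-relation u v x y ux+vy≡0 = begin
  ∣ u ∣ * x              ≡⟨ ℤ.abs-* u (ℤ.+ x) ⟨
  ∣ u ℤ.* ℤ.+ x ∣        ≡⟨ cong ∣_∣ (inverseˡ-unique (u ℤ.* ℤ.+ x) (v ℤ.* ℤ.+ y) ux+vy≡0) ⟩
  ∣ ℤ.- (v ℤ.* ℤ.+ y) ∣  ≡⟨ ℤ.∣-i∣≡∣i∣ (v ℤ.* ℤ.+ y) ⟩
  ∣ v ℤ.* ℤ.+ y ∣        ≡⟨ ℤ.abs-* v (ℤ.+ y) ⟩
  ∣ v ∣ * y              ∎
  where open ≡-Reasoning

toℚᵘ-ℕ→ℚ : ∀ x → toℚᵘ (ℕ→ℚ x) ≡ ℚᵘ.mkℚᵘ (ℤ.+ x) 0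
toℚᵘ-ℕ→ℚ x = cong toℚᵘ (normalize-coprime (λ (_ , d∣1) → ∣1⇒≡1 d∣1))

toℚᵘ-linear-form : ∀ a b x y →
  toℚᵘ (a *ℚ ℕ→ℚ x +ℚ (b *ℚ ℕ→ℚ y +ℚ 0ℚ)) ℚᵘ.≃
  toℚᵘ a ℚᵘ.* ℚᵘ.mkℚᵘ (ℤ.+ x) 0 ℚᵘ.+ (toℚᵘ b ℚᵘ.* ℚᵘ.mkℚᵘ (ℤ.+ y) 0 ℚᵘ.+ ℚᵘ.0ℚᵘ)
toℚᵘ-linear-form a b x y =
  ℚᵘ.≃-trans (toℚᵘ-homo-+ (a *ℚ ℕ→ℚ x) (b *ℚ ℕ→ℚ y +ℚ 0ℚ))
    (ℚᵘ.+-cong (toℚᵘ-term a x)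
      (ℚᵘ.≃-trans (toℚᵘ-homo-+ (b *ℚ ℕ→ℚ y) 0ℚ) (ℚᵘ.+-cong (toℚᵘ-term b y) ℚᵘ.≃-refl)))
  where
    toℚᵘ-term : ∀ c z → toℚᵘ (c *ℚ ℕ→ℚ z) ℚᵘ.≃ toℚᵘ c ℚᵘ.* ℚᵘ.mkℚᵘ (ℤ.+ z) 0
    toℚᵘ-term c z =
      ℚᵘ.≃-trans (toℚᵘ-homo-* c (ℕ→ℚ z)) (ℚᵘ.*-congˡ {toℚᵘ c} (ℚᵘ.≃-reflexive (toℚᵘ-ℕ→ℚ z)))

-- Cross-multiplying the ℚᵘ equation leaves the denominators in the raw forms suc (db * 1 * 1) and suc (da * 1).
kernel-integer : ∀ a b x y → a *ℚ ℕ→ℚ x +ℚ (b *ℚ ℕ→ℚ y +ℚ 0ℚ) ≡ 0ℚ →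
  (↥ a ℤ.* ↧ b) ℤ.* ℤ.+ x ℤ.+ (↥ b ℤ.* ↧ a) ℤ.* ℤ.+ y ≡ 0ℤ
kernel-integer a@(mkℚ na da _) b@(mkℚ nb db _) x y ax+by≡0
  with ℚᵘ.≃-trans (ℚᵘ.≃-sym (toℚᵘ-linear-form a b x y)) (toℚᵘ-cong ax+by≡0)
... | ℚᵘ.*≡* e = begin
  (na ℤ.* ℤ.+ suc db) ℤ.* ℤ.+ x ℤ.+ (nb ℤ.* ℤ.+ suc da) ℤ.* ℤ.+ y
    ≡⟨ cong₂ (λ p q → (na ℤ.* ℤ.+ suc p) ℤ.* ℤ.+ x ℤ.+ (nb ℤ.* ℤ.+ suc q) ℤ.* ℤ.+ y)
             (trans (ℕ.*-identityʳ (db * 1)) (ℕ.*-identityʳ db)) (ℕ.*-identityʳ da) ⟨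
  (na ℤ.* ℤ.+ suc (db * 1 * 1)) ℤ.* ℤ.+ x ℤ.+ (nb ℤ.* ℤ.+ suc (da * 1)) ℤ.* ℤ.+ y
    ≡⟨ rearrange na (ℤ.+ x) (ℤ.+ suc (db * 1 * 1)) nb (ℤ.+ y) (ℤ.+ suc (da * 1)) ⟨
  _ ≡⟨ e ⟩
  0ℤ ∎
  where
    open ≡-Reasoning
    rearrange : ∀ na x db nb y da →
      ((na ℤ.* x) ℤ.* db ℤ.+ ((nb ℤ.* y) ℤ.* 1ℤ ℤ.+ 0ℤ) ℤ.* da) ℤ.* 1ℤ ≡
      (na ℤ.* db) ℤ.* x ℤ.+ (nb ℤ.* da) ℤ.* y
    rearrange = ℤ-solve-∀

cross-weight : ℚ → ℚ → ℕ
cross-weight a b = ∣ ↥ a ℤ.* ↧ b ∣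

cross-weight≡0⇒≡0 : ∀ a b → cross-weight a b ≡ 0 → a ≡ 0ℚ
cross-weight≡0⇒≡0 a b@(mkℚ _ _ _) w≡0 with ℤ.i*j≡0⇒i≡0∨j≡0 (↥ a) (ℤ.∣i∣≡0⇒i≡0 w≡0)
... | inj₁ ↥a≡0 = ↥p≡0⇒p≡0 a ↥a≡0
... | inj₂ ()

kernel-weights : ∀ a b x y → a *ℚ ℕ→ℚ x +ℚ (b *ℚ ℕ→ℚ y +ℚ 0ℚ) ≡ 0ℚ →
  cross-weight a b * x ≡ cross-weight b a * y
kernel-weights a b x y ax+by≡0 =
  abs-relation (↥ a ℤ.* ↧ b) (↥ b ℤ.* ↧ a) x y (kernel-integer a b x y ax+by≡0)

nonzero-weights : (A : Matrix 1 2) → NonzeroMatrix A →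
  ¬ (cross-weight (A zero zero) (A zero (suc zero)) ≡ 0 × cross-weight (A zero (suc zero)) (A zero zero) ≡ 0)
nonzero-weights A (zero , zero , a≢0) (P≡0 , _) =
  a≢0 (cross-weight≡0⇒≡0 (A zero zero) (A zero (suc zero)) P≡0)
nonzero-weights A (zero , suc zero , b≢0) (_ , Q≡0) =
  b≢0 (cross-weight≡0⇒≡0 (A zero (suc zero)) (A zero zero) Q≡0)

lemma1 : (A : Matrix 1 2) → NonzeroMatrix A → ¬ RainbowRegular A
lemma1 A A≢0 (K , regular) with line-colouring K (nonzero-weights A A≢0)
... | k , K≤k , n , 1≤n , c , c-equinumerous , c-blocks with regular k K≤k n 1≤n c c-equinumerous
... | x , x-rainbow , x∈ker =
  0≢1+n (x-rainbow zero (suc zero) (c-blocks (x zero) (x (suc zero))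
    (kernel-weights (A zero zero) (A zero (suc zero)) (elem (x zero)) (elem (x (suc zero))) (x∈ker zero))))
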